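{- Let $\Gamma$ be a finite multiset of $\rightarrow$-formulas and $E$, $F$ be $\rightarrow$-formulas such that both sequents $\Gamma\Rightarrow E$ and $\Gamma\Rightarrow F$ are binary, and $E$ and $F$ have no atom in common. Then the set of relevant formulas of $\Gamma\Rightarrow E$ and the set of relevant formulas of $\Gamma\Rightarrow F$ are disjoint (no member of $\Gamma$ is relevant for both sequents).
   Context: Fix a language with infinitely many propositional atoms. A $\rightarrow$-formula is built from atoms using only the binary connective $\rightarrow$. A $\rightarrow$-sequent is a pair $\Gamma\Rightarrow G$ where $\Gamma$ is a finite multiset of $\rightarrow$-formulas and $G$ is a $\rightarrow$-formula. A sequent is binary iff no atom occurs in it (counting occurrences in all members of the antecedent and in the succedent) more than twice. The head of a $\rightarrow$-formula is defined by: an atom is its own head; the head of $A\rightarrow B$ is the head of $B$. For a binary sequent $\Gamma\Rightarrow G$, the relevant formulas are the elements (occurrences) of the smallest collection $S$ of members of $\Gamma$ such that: (1) every member of $\Gamma$ whose head occurs in $G$ is in $S$; (2) every member of $\Gamma$ whose head occurs in some element of $S$ is in $S$. -}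

module Defs where

open import Data.Nat using (ℕ; _+_; _≤_)
open import Data.Nat.Properties using (_≟_)
open import Data.List using (List; length; lookup; map)
open import Data.Nat.ListAction using (sum)
open import Data.Fin using (Fin)
open import Relation.Nullary using (yes; no)

Atom : Set
Atom = ℕ

data Fml : Set where
  atom : Atom → Fml
  _⇒_  : Fml → Fml → Fml

infixr 5 _⇒_

count : Atom → Fml → ℕ
count p (atom q) with p ≟ q
... | yes _ = 1
... | no  _ = 0
count p (A ⇒ B) = count p A + count p B

data OccursIn (p : Atom) : Fml → Set where
  here  : OccursIn p (atom p)
  left  : ∀ {A B} → OccursIn p A → OccursIn p (A ⇒ B)
  right : ∀ {A B} → OccursIn p B → OccursIn p (A ⇒ B)

head : Fml → Atom
head (atom p) = p
head (A ⇒ B)  = head B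

-- A sequent Γ ⇒ G with Γ a finite multiset, represented as a list
-- (members of Γ are identified by their position, i.e. as occurrences).
Binary : List Fml → Fml → Set
Binary Γ G = ∀ (p : Atom) → sum (map (count p) Γ) + count p G ≤ 2

data Relevant (Γ : List Fml) (G : Fml) : Fin (length Γ) → Set where
  base : ∀ {i} → OccursIn (head (lookup Γ i)) G → Relevant Γ G i
  step : ∀ {i j} → Relevant Γ G j → OccursIn (head (lookup Γ i)) (lookup Γ j)
       → Relevant Γ G i

-- The head p of Γᵢ occurs in Γᵢ, so in a binary sequent Γ ⇒ G it occurs in at most one
-- further place. Hence if Γᵢ is relevant and p occurs in some other Γₖ, then p is not in G
-- and every derivation of relevance for Γᵢ must go through Γₖ: rule (2) can be run
-- backwards. Now induct on why Γᵢ is relevant for Γ ⇒ E. If p occurs in E, then p occurs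
-- neither in F (no common atom) nor in any Γⱼ with j ≠ i (binarity of Γ ⇒ E), so Γᵢ has no
-- way to be relevant for Γ ⇒ F. If p occurs in an E-relevant Γⱼ, then F-relevance of Γᵢ
-- transfers backwards to Γⱼ, contradicting the induction hypothesis.
module Submission where

open import Defs
open import Data.List using (List; length; _∷_; lookup; map)
open import Data.Nat.ListAction using (sum)
open import Data.Nat using (ℕ; _≤_; z≤n; s≤s)
import Data.Nat as ℕ
open import Data.Nat.Properties using (≤-trans; +-mono-≤; m≤m+n; m≤n+m; +-comm; ≤-reflexive; <⇒≱)
open import Data.Fin using (Fin; zero; suc)
open import Data.Fin.Properties using (_≟_; 0≢1+n; suc-injective)
open import Data.Empty using (⊥; ⊥-elim)
open import Data.Sum using (_⊎_; inj₁; inj₂)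
open import Data.Product using (_×_; _,_; ∃-syntax)
open import Function using (_∘_)
open import Relation.Nullary using (¬_; yes; no)
open import Relation.Binary.PropositionalEquality using (_≢_; refl; cong)

module _ {A : Set} (f : A → ℕ) where

  positive-lookup⇒1≤sum : ∀ (xs : List A) a → 1 ≤ f (lookup xs a) → 1 ≤ sum (map f xs)
  positive-lookup⇒1≤sum (x ∷ xs) zero    pos = ≤-trans pos (m≤m+n (f x) _)
  positive-lookup⇒1≤sum (x ∷ xs) (suc a) pos =
    ≤-trans (positive-lookup⇒1≤sum xs a pos) (m≤n+m _ (f x))

  two-positive-lookups⇒2≤sum : ∀ (xs : List A) {a b} → a ≢ b →
    1 ≤ f (lookup xs a) → 1 ≤ f (lookup xs b) → 2 ≤ sum (map f xs)
  two-positive-lookups⇒2≤sum (x ∷ xs) {zero}  {zero}  a≢b _    _    = ⊥-elim (a≢b refl)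
  two-positive-lookups⇒2≤sum (x ∷ xs) {zero}  {suc b} _   posa posb =
    +-mono-≤ posa (positive-lookup⇒1≤sum xs b posb)
  two-positive-lookups⇒2≤sum (x ∷ xs) {suc a} {zero}  _   posa posb =
    +-mono-≤ posb (positive-lookup⇒1≤sum xs a posa)
  two-positive-lookups⇒2≤sum (x ∷ xs) {suc a} {suc b} a≢b posa posb =
    ≤-trans (two-positive-lookups⇒2≤sum xs (a≢b ∘ cong suc) posa posb) (m≤n+m _ (f x))

  three-positive-lookups⇒3≤sum : ∀ (xs : List A) {a b c} → a ≢ b → a ≢ c → b ≢ c →
    1 ≤ f (lookup xs a) → 1 ≤ f (lookup xs b) → 1 ≤ f (lookup xs c) → 3 ≤ sum (map f xs)
  three-positive-lookups⇒3≤sum (x ∷ xs) {zero}  {zero}          a≢b _   _   _ _ _ = ⊥-elim (a≢b refl)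
  three-positive-lookups⇒3≤sum (x ∷ xs) {zero}  {suc _} {zero}  _   a≢c _   _ _ _ = ⊥-elim (a≢c refl)
  three-positive-lookups⇒3≤sum (x ∷ xs) {suc _} {zero}  {zero}  _   _   b≢c _ _ _ = ⊥-elim (b≢c refl)
  three-positive-lookups⇒3≤sum (x ∷ xs) {zero}  {suc _} {suc _} _ _ b≢c posa posb posc =
    +-mono-≤ posa (two-positive-lookups⇒2≤sum xs (b≢c ∘ cong suc) posb posc)
  three-positive-lookups⇒3≤sum (x ∷ xs) {suc _} {zero}  {suc _} _ a≢c _ posa posb posc =
    +-mono-≤ posb (two-positive-lookups⇒2≤sum xs (a≢c ∘ cong suc) posa posc)
  three-positive-lookups⇒3≤sum (x ∷ xs) {suc _} {suc _} {zero}  a≢b _ _ posa posb posc =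
    +-mono-≤ posc (two-positive-lookups⇒2≤sum xs (a≢b ∘ cong suc) posa posb)
  three-positive-lookups⇒3≤sum (x ∷ xs) {suc _} {suc _} {suc _} a≢b a≢c b≢c posa posb posc =
    ≤-trans (three-positive-lookups⇒3≤sum xs (a≢b ∘ cong suc) (a≢c ∘ cong suc) (b≢c ∘ cong suc)
                                          posa posb posc)
            (m≤n+m _ (f x))

occurs⇒1≤count : ∀ {p A} → OccursIn p A → 1 ≤ count p A
occurs⇒1≤count {p} here with p ℕ.≟ p
... | yes _   = s≤s z≤n
... | no p≢p  = ⊥-elim (p≢p refl)
occurs⇒1≤count {p} {A ⇒ B} (left  o) = ≤-trans (occurs⇒1≤count o) (m≤m+n _ (count p B))
occurs⇒1≤count {p} {A ⇒ B} (right o) = ≤-trans (occurs⇒1≤count o) (m≤n+m _ (count p A))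

head-occurs : ∀ A → OccursIn (head A) A
head-occurs (atom p) = here
head-occurs (A ⇒ B)  = right (head-occurs B)

binary⇒¬occurs-thrice : ∀ Γ G → Binary Γ G → ∀ {p} {a b c : Fin (ℕ.suc (length Γ))} →
  a ≢ b → a ≢ c → b ≢ c →
  OccursIn p (lookup (G ∷ Γ) a) → OccursIn p (lookup (G ∷ Γ) b) → OccursIn p (lookup (G ∷ Γ) c) → ⊥
binary⇒¬occurs-thrice Γ G binary {p} a≢b a≢c b≢c oa ob oc =
  <⇒≱ (s≤s (s≤s (s≤s z≤n)))
    (≤-trans (three-positive-lookups⇒3≤sum (count p) (G ∷ Γ) a≢b a≢c b≢c
                (occurs⇒1≤count oa) (occurs⇒1≤count ob) (occurs⇒1≤count oc))
             (≤-trans (≤-reflexive (+-comm (count p G) _)) (binary p)))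

module _ {Γ : List Fml} {G : Fml} where

  relevant⇒head-occurs-elsewhere : ∀ {i} → Relevant Γ G i →
    OccursIn (head (lookup Γ i)) G ⊎
    ∃[ j ] (i ≢ j × Relevant Γ G j × OccursIn (head (lookup Γ i)) (lookup Γ j))
  relevant⇒head-occurs-elsewhere (base g) = inj₁ g
  relevant⇒head-occurs-elsewhere {i} (step {j = j} r o) with i ≟ j
  ... | yes refl = relevant⇒head-occurs-elsewhere r
  ... | no i≢j   = inj₂ (j , i≢j , r , o)

  relevant-at-head-occurrence : Binary Γ G → ∀ {i k} → OccursIn (head (lookup Γ i)) (lookup Γ k) →
    Relevant Γ G i → Relevant Γ G k
  relevant-at-head-occurrence binary {i} {k} o r with i ≟ k
  ... | yes refl = r
  ... | no i≢k with relevant⇒head-occurs-elsewhere r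
  ...   | inj₁ g = ⊥-elim (binary⇒¬occurs-thrice Γ G binary 0≢1+n 0≢1+n (i≢k ∘ suc-injective)
                            g (head-occurs (lookup Γ i)) o)
  ...   | inj₂ (j , i≢j , rj , oj) with j ≟ k
  ...     | yes refl = rj
  ...     | no j≢k   = ⊥-elim (binary⇒¬occurs-thrice Γ G binary
                                 (i≢j ∘ suc-injective) (i≢k ∘ suc-injective) (j≢k ∘ suc-injective)
                                 (head-occurs (lookup Γ i)) oj o)

module _ {Γ : List Fml} {E F : Fml} (binaryE : Binary Γ E) (binaryF : Binary Γ F)
         (E#F : ∀ (p : Atom) → OccursIn p E → ¬ OccursIn p F) where

  relevant-disjoint : ∀ {i} → Relevant Γ E i → ¬ Relevant Γ F i
  relevant-disjoint {i} (base e) rF with relevant⇒head-occurs-elsewhere rF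
  ... | inj₁ f = E#F _ e f
  ... | inj₂ (j , i≢j , _ , o) =
    binary⇒¬occurs-thrice Γ E binaryE 0≢1+n 0≢1+n (i≢j ∘ suc-injective) e (head-occurs (lookup Γ i)) o
  relevant-disjoint (step rE o) rF = relevant-disjoint rE (relevant-at-head-occurrence binaryF o rF)

lemma4p2 : (Γ : List Fml) (E F : Fml) → Binary Γ E → Binary Γ F
    → (∀ (p : Atom) → OccursIn p E → ¬ OccursIn p F)
    → ∀ (i : Fin (length Γ)) → Relevant Γ E i → ¬ Relevant Γ F i
lemma4p2 Γ E F binaryE binaryF E#F i = relevant-disjoint binaryE binaryF E#F
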